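{- Let $n\ge 16$ and $S_{1,3}=\{+1,-1,+3,-3\}$. In the Cayley graph $\Gamma(\mathbb Z/n\mathbb Z,S_{1,3})$, every type A edge $\{g,g+1\}$ has Ricci curvature $\kappa=\frac12$ and every type B edge $\{g,g+3\}$ has Ricci curvature $\kappa=0$.
   Context: Let $G=(V,E)$ be a finite connected simple undirected graph with graph distance $d$, $N(x)$ the set of neighbors of $x$, and $\deg(x)=|N(x)|$. For $\alpha\in[0,1]$ and $x\in V$ define the probability measure $\mu_x^\alpha$ on $V$ by $\mu_x^\alpha(x)=\alpha$, $\mu_x^\alpha(v)=\frac{1-\alpha}{\deg(x)}$ for $v\in N(x)$, and $\mu_x^\alpha(v)=0$ otherwise. For probability measures $\mu,\nu$ on $V$, the 1-Wasserstein distance is $W_1(\mu,\nu)=\inf_\pi\sum_{x,y\in V}d(x,y)\pi(x,y)$, the infimum over all $\pi:V\times V\to[0,1]$ with $\sum_y\pi(x,y)=\mu(x)$ and $\sum_x\pi(x,y)=\nu(y)$. For $x\neq y$, $\kappa_\alpha(x,y)=1-\frac{W_1(\mu_x^\alpha,\mu_y^\alpha)}{d(x,y)}$, and the Ricci curvature (of Lin–Lu–Yau) is $\kappa(x,y)=\lim_{\alpha\to1}\frac{\kappa_\alpha(x,y)}{1-\alpha}$. For the additive cyclic group $\mathbb Z/n\mathbb Z$ and a symmetric generating set $S$ not containing $0$, the Cayley graph $\Gamma(\mathbb Z/n\mathbb Z,S)$ is the simple undirected graph with vertex set $\mathbb Z/n\mathbb Z$ and edge set $\{\{g,g+s\}: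 g\in\mathbb Z/n\mathbb Z,\ s\in S\}$.
   Formalization: The parameter α in the limit defining κ ranges over the rationals in [0,1), and the couplings π in the 1-Wasserstein distance take rational values. -}

module Defs where

open import Data.Bool using (Bool; true; false; _∧_; _∨_; if_then_else_)
open import Data.Nat as ℕ using (ℕ; zero; suc; NonZero)
open import Data.Integer as ℤ using (ℤ; +_)
open import Data.Integer.DivMod using (_%ℕ_; n%ℕd<d)
open import Data.Fin using (Fin; toℕ; fromℕ<)
open import Data.Fin.Properties using () renaming (_≟_ to _≟ᶠ_)
open import Data.List using (List; foldr; map; _∷_; [])
open import Data.Bool.ListAction using (any)
open import Data.List.Base using (allFin)
open import Data.Rational as ℚ using (ℚ; 0ℚ; 1ℚ; _+_; _*_; _-_; _≤_; _<_; ∣_∣; 1/_; ≢-nonZero)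
open import Data.Rational.Properties using () renaming (_≟_ to _≟ℚ_)
open import Data.Product using (Σ; _×_; ∃)
open import Relation.Nullary using (yes; no; does)

Graph : ℕ → Set
Graph n = Fin n → Fin n → Bool

within : ∀ {n} → Graph n → ℕ → Fin n → Fin n → Bool
within G zero    x y = does (x ≟ᶠ y)
within {n} G (suc k) x y =
  within G k x y ∨ any (λ z → G x z ∧ within G k z y) (allFin n)

-- least k < fuel with p k = true (returns fuel if none)
firstTrue : ℕ → (ℕ → Bool) → ℕ
firstTrue zero    p = zero
firstTrue (suc f) p = if p zero then zero else suc (firstTrue f (λ k → p (suc k)))

-- graph distance d(x,y): the least k with a walk of length k from x to y
-- (for a connected graph on n vertices this is < n)
dist : ∀ {n} → Graph n → Fin n → Fin n → ℕ
dist {n} G x y = firstTrue n (λ k → within G k x y)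

deg : ∀ {n} → Graph n → Fin n → ℕ
deg {n} G x = foldr ℕ._+_ 0 (map (λ z → if G x z then 1 else 0) (allFin n))

ℕtoℚ : ℕ → ℚ
ℕtoℚ k = (+ k) ℚ./ 1

-- 1/p for p ≠ 0 (only ever applied to nonzero values below; 0 ↦ 0)
qinv : ℚ → ℚ
qinv p with p ≟ℚ 0ℚ
... | yes _ = 0ℚ
... | no p≢0 = (1/ p) {{≢-nonZero p≢0}}

sumFin : ∀ n → (Fin n → ℚ) → ℚ
sumFin n f = foldr _+_ 0ℚ (map f (allFin n))

μ : ∀ {n} → Graph n → ℚ → Fin n → Fin n → ℚ
μ G α x v =
  if does (x ≟ᶠ v) then α
  else if G x v then (1ℚ - α) * qinv (ℕtoℚ (deg G x))
  else 0ℚ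

IsCoupling : ∀ {n} → (Fin n → ℚ) → (Fin n → ℚ) → (Fin n → Fin n → ℚ) → Set
IsCoupling {n} m1 m2 π =
  (∀ x y → 0ℚ ≤ π x y) × (∀ x y → π x y ≤ 1ℚ)
  × (∀ x → sumFin n (λ y → π x y) ≡ m1 x)
  × (∀ y → sumFin n (λ x → π x y) ≡ m2 y)
  where open import Relation.Binary.PropositionalEquality using (_≡_)

cost : ∀ {n} → Graph n → (Fin n → Fin n → ℚ) → ℚ
cost {n} G π = sumFin n (λ x → sumFin n (λ y → ℕtoℚ (dist G x y) * π x y))

IsW1 : ∀ {n} → Graph n → (Fin n → ℚ) → (Fin n → ℚ) → ℚ → Set
IsW1 G m1 m2 w =
  (∀ π → IsCoupling m1 m2 π → w ≤ cost G π)
  × (∀ ε → 0ℚ < ε → ∃ λ π → IsCoupling m1 m2 π × (cost G π < w + ε))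

κα : ∀ {n} → Graph n → Fin n → Fin n → ℚ → ℚ
κα G x y W = 1ℚ - W * qinv (ℕtoℚ (dist G x y))

IsRicci : ∀ {n} → Graph n → Fin n → Fin n → ℚ → Set
IsRicci G x y c =
  ∀ ε → 0ℚ < ε → ∃ λ δ → 0ℚ < δ ×
    (∀ α → 0ℚ ≤ α → α < 1ℚ → 1ℚ - δ < α →
      ∃ λ W → IsW1 G (μ G α x) (μ G α y) W ×
        (∣ κα G x y W * qinv (1ℚ - α) - c ∣ < ε))

shift : ∀ {n} .{{_ : NonZero n}} → Fin n → ℤ → Fin n
shift {n} g s = fromℕ< (n%ℕd<d ((+ toℕ g) ℤ.+ s) n)

cayley : ∀ n .{{_ : NonZero n}} → List ℤ → Graph n
cayley n S g h = any (λ s → does (h ≟ᶠ shift g s)) S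

S₁₃ : List ℤ
S₁₃ = + 1 ∷ ℤ.- (+ 1) ∷ + 3 ∷ ℤ.- (+ 3) ∷ []

-- For α ∈ [½, 1) both transport distances are computed exactly. An explicit transport
-- plan bounds W₁ from above; a 1-Lipschitz potential f bounds it from below, since
-- ∑ f μ − ∑ f ν is at most the cost of any coupling. Count vertices as offsets from g − 9;
-- each neighbour of an endpoint receives mass β = (1 − α)/4.
-- Type A edge {g, g + 1}: keep β at g and at g + 1, move α − β from g to g + 1 and the other
-- three β-masses one step each. This costs α + 2β = α + (1 − α)/2, and so does the
-- potential gap of the indicator of the offsets {6, 8, 9, 12}.
-- Type B edge {g, g + 3}: translate everything by 3, at cost α + 4β = 1, matched by the
-- tent r ↦ 3 − ⌈|r − 6|/3⌉.
-- Both edges have length 1, so κ_α/(1 − α) is ½, resp. 0, on all of [½, 1).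
-- The bound n ≥ 16 keeps the offsets 0, …, 15 distinct and lets both potentials stay ≤ 1
-- within distance 3 of offset 0, which keeps them Lipschitz across the wrap-around.

module Submission where

open import Data.Bool using (Bool; true; false; T; if_then_else_)
open import Data.Bool.ListAction using (any)
open import Data.Bool.Properties using (T-∨; T-∧; T-≡)
open import Data.Fin using (Fin; zero; suc; toℕ)
open import Data.Fin.Properties using (toℕ-fromℕ<; toℕ-injective; toℕ<n) renaming (_≟_ to _≟ᶠ_)
open import Data.Integer as ℤ using (-[1+_]; _⊖_)
import Data.Integer.Properties as ℤ
open import Data.List using (List; []; _∷_; foldr; map; tabulate; allFin)
open import Data.List.Membership.Propositional using (lose)
open import Data.List.Membership.Propositional.Properties using (∈-allFin)
open import Data.List.Properties using (map-tabulate; tabulate-cong; map-∘)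
open import Data.List.Relation.Unary.All as All using (All; []; _∷_)
open import Data.List.Relation.Unary.Any using (here; there; satisfied)
open import Data.List.Relation.Unary.Any.Properties using (any⁺; any⁻)
open import Data.List.Relation.Unary.Unique.Propositional using (Unique; []; _∷_)
open import Data.Nat as ℕ using (ℕ; zero; suc; z≤n; s≤s; NonZero; _≥_)
open import Data.Nat.Coprimality using (1-coprimeTo) renaming (sym to coprime-sym)
open import Data.Nat.DivMod using (m<n⇒m%n≡m; [m+n]%n≡m%n; %-distribˡ-+; m%n%n≡m%n; n%n≡0; m%n<n; /-monoˡ-≤)
import Data.Nat.Properties as ℕ
open import Algebra.Properties.CommutativeSemigroup ℕ.+-commutativeSemigroup using () renaming (xy∙z≈xz∙y to +-rightComm)
open import Data.Product using (_×_; _,_; ∃; proj₁; proj₂)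
open import Data.Rational as ℚ using (ℚ; mkℚ; 0ℚ; 1ℚ; ½; ∣_∣; *≤*)
import Data.Rational.Properties as ℚ
open import Data.Rational.Solver using (module +-*-Solver)
open import Data.Sum using (_⊎_; inj₁; inj₂)
open import Function using (_∘_; id)
open import Function.Bundles using (Equivalence)
open import Relation.Binary.PropositionalEquality
open import Relation.Nullary using (Dec; yes; no; does; contradiction)
open import Relation.Nullary.Decidable using (dec-true; dec-false; toWitness; _×-dec_)
open import Defs

open +-*-Solver using (solve; _:=_; con; _:+_; _:*_; _:-_; Polynomial)

module Cyclic (N : ℕ) .{{_ : NonZero N}} where

  open import Data.Nat using (_+_; _∸_; _%_; _≤_; _<_)

  infixl 6 _⊕_

  _⊕_ : Fin N → ℕ → Fin N
  x ⊕ o = shift x (ℤ.+ o)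

  toℕ-⊕ : ∀ x o → toℕ (x ⊕ o) ≡ (toℕ x + o) % N
  toℕ-⊕ x o = toℕ-fromℕ< _

  %-absorbˡ : ∀ a b → (a % N + b) % N ≡ (a + b) % N
  %-absorbˡ a b = begin
    (a % N + b) % N             ≡⟨ %-distribˡ-+ (a % N) b N ⟩
    (a % N % N + b % N) % N     ≡⟨ cong (λ r → (r + b % N) % N) (m%n%n≡m%n a N) ⟩
    (a % N + b % N) % N         ≡⟨ %-distribˡ-+ a b N ⟨
    (a + b) % N                 ∎
    where open ≡-Reasoning

  ⊕-assoc : ∀ x a b → x ⊕ a ⊕ b ≡ x ⊕ (a + b)
  ⊕-assoc x a b = toℕ-injective (begin
    toℕ (x ⊕ a ⊕ b)               ≡⟨ toℕ-⊕ (x ⊕ a) b ⟩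
    (toℕ (x ⊕ a) + b) % N         ≡⟨ cong (λ r → (r + b) % N) (toℕ-⊕ x a) ⟩
    ((toℕ x + a) % N + b) % N     ≡⟨ %-absorbˡ (toℕ x + a) b ⟩
    (toℕ x + a + b) % N           ≡⟨ cong (_% N) (ℕ.+-assoc (toℕ x) a b) ⟩
    (toℕ x + (a + b)) % N         ≡⟨ toℕ-⊕ x (a + b) ⟨
    toℕ (x ⊕ (a + b))             ∎)
    where open ≡-Reasoning

  ⊕-identityʳ : ∀ x → x ⊕ 0 ≡ x
  ⊕-identityʳ x = toℕ-injective (trans (toℕ-⊕ x 0)
    (trans (cong (_% N) (ℕ.+-identityʳ (toℕ x))) (m<n⇒m%n≡m (toℕ<n x))))

  ⊕-period : ∀ x o → x ⊕ (o + N) ≡ x ⊕ o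
  ⊕-period x o = toℕ-injective (begin
    toℕ (x ⊕ (o + N))             ≡⟨ toℕ-⊕ x (o + N) ⟩
    (toℕ x + (o + N)) % N         ≡⟨ cong (_% N) (ℕ.+-assoc (toℕ x) o N) ⟨
    (toℕ x + o + N) % N           ≡⟨ [m+n]%n≡m%n (toℕ x + o) N ⟩
    (toℕ x + o) % N               ≡⟨ toℕ-⊕ x o ⟨
    toℕ (x ⊕ o)                   ∎)
    where open ≡-Reasoning

  offset : Fin N → Fin N → ℕ
  offset b v = (toℕ v + (N ∸ toℕ b)) % N

  offset<N : ∀ b v → offset b v < N
  offset<N b v = m%n<n _ N

  offset-⊕ : ∀ b x o → offset b (x ⊕ o) ≡ (offset b x + o) % N
  offset-⊕ b x o = begin
    (toℕ (x ⊕ o) + (N ∸ toℕ b)) % N          ≡⟨ cong (λ r → (r + (N ∸ toℕ b)) % N) (toℕ-⊕ x o) ⟩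
    ((toℕ x + o) % N + (N ∸ toℕ b)) % N      ≡⟨ %-absorbˡ (toℕ x + o) _ ⟩
    (toℕ x + o + (N ∸ toℕ b)) % N            ≡⟨ cong (_% N) (+-rightComm (toℕ x) o _) ⟩
    (toℕ x + (N ∸ toℕ b) + o) % N            ≡⟨ %-absorbˡ (toℕ x + (N ∸ toℕ b)) o ⟨
    (offset b x + o) % N                     ∎
    where open ≡-Reasoning

  offset-self : ∀ b → offset b b ≡ 0
  offset-self b = trans (cong (_% N) (ℕ.m+[n∸m]≡n (ℕ.<⇒≤ (toℕ<n b)))) (n%n≡0 N)

  offset-⊕-self : ∀ b o → o < N → offset b (b ⊕ o) ≡ o
  offset-⊕-self b o o<N = begin
    offset b (b ⊕ o)          ≡⟨ offset-⊕ b b o ⟩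
    (offset b b + o) % N      ≡⟨ cong (λ r → (r + o) % N) (offset-self b) ⟩
    o % N                     ≡⟨ m<n⇒m%n≡m o<N ⟩
    o                         ∎
    where open ≡-Reasoning

  ⊕-cancelˡ : ∀ b {o o′} → o < N → o′ < N → b ⊕ o ≡ b ⊕ o′ → o ≡ o′
  ⊕-cancelˡ b {o} {o′} o<N o′<N eq =
    trans (sym (offset-⊕-self b o o<N)) (trans (cong (offset b) eq) (offset-⊕-self b o′ o′<N))

  ⊖-%ℕ : ∀ x s → s < N → (x ⊖ s) ℤ.%ℕ N ≡ (x + (N ∸ s)) % N
  ⊖-%ℕ x s s<N with s ℕ.≤? x
  ... | yes s≤x rewrite ℤ.⊖-≥ s≤x = sym (begin
    (x + (N ∸ s)) % N           ≡⟨ cong (_% N) x+[N∸s]≡[x∸s]+N ⟩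
    ((x ∸ s) + N) % N           ≡⟨ [m+n]%n≡m%n (x ∸ s) N ⟩
    (x ∸ s) % N                 ∎)
    where
    open ≡-Reasoning
    x+[N∸s]≡[x∸s]+N : x + (N ∸ s) ≡ (x ∸ s) + N
    x+[N∸s]≡[x∸s]+N = begin
      x + (N ∸ s)               ≡⟨ cong (_+ (N ∸ s)) (ℕ.m∸n+n≡m s≤x) ⟨
      (x ∸ s) + s + (N ∸ s)     ≡⟨ ℕ.+-assoc (x ∸ s) s (N ∸ s) ⟩
      (x ∸ s) + (s + (N ∸ s))   ≡⟨ cong ((x ∸ s) +_) (ℕ.m+[n∸m]≡n (ℕ.<⇒≤ s<N)) ⟩
      (x ∸ s) + N               ∎
  ... | no s≰x rewrite ℤ.⊖-< (ℕ.≰⇒> s≰x) = begin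
    (ℤ.- (ℤ.+ (s ∸ x))) ℤ.%ℕ N        ≡⟨ negative-%ℕ (s ∸ x) 0<s∸x (ℕ.≤-<-trans (ℕ.m∸n≤m s x) s<N) ⟩
    N ∸ (s ∸ x)                     ≡⟨ cong (_∸ (s ∸ x)) decompose ⟨
    x + (N ∸ s) + (s ∸ x) ∸ (s ∸ x) ≡⟨ ℕ.m+n∸n≡m (x + (N ∸ s)) (s ∸ x) ⟩
    x + (N ∸ s)                     ≡⟨ m<n⇒m%n≡m x+[N∸s]<N ⟨
    (x + (N ∸ s)) % N               ∎
    where
    open ≡-Reasoning
    x<s : x < s
    x<s = ℕ.≰⇒> s≰x
    0<s∸x : 0 < s ∸ x
    0<s∸x = ℕ.m<n⇒0<n∸m x<s
    negative-%ℕ : ∀ t → 0 < t → t < N → (ℤ.- (ℤ.+ t)) ℤ.%ℕ N ≡ N ∸ t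
    negative-%ℕ (suc t) _ t<N rewrite m<n⇒m%n≡m t<N = refl
    decompose : x + (N ∸ s) + (s ∸ x) ≡ N
    decompose = begin
      x + (N ∸ s) + (s ∸ x)     ≡⟨ cong (_+ (s ∸ x)) (ℕ.+-comm x (N ∸ s)) ⟩
      (N ∸ s) + x + (s ∸ x)     ≡⟨ ℕ.+-assoc (N ∸ s) x (s ∸ x) ⟩
      (N ∸ s) + (x + (s ∸ x))   ≡⟨ cong ((N ∸ s) +_) (ℕ.m+[n∸m]≡n (ℕ.<⇒≤ x<s)) ⟩
      (N ∸ s) + s               ≡⟨ ℕ.m∸n+n≡m (ℕ.<⇒≤ s<N) ⟩
      N                         ∎
    x+[N∸s]<N : x + (N ∸ s) < N
    x+[N∸s]<N = subst (x + (N ∸ s) <_) decompose (ℕ.m<m+n (x + (N ∸ s)) 0<s∸x)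

  shift-negative : ∀ x j → suc j < N → shift x -[1+ j ] ≡ x ⊕ (N ∸ suc j)
  shift-negative x j sj<N = toℕ-injective (trans (toℕ-fromℕ< _)
    (trans (⊖-%ℕ (toℕ x) (suc j) sj<N) (sym (toℕ-⊕ x (N ∸ suc j)))))

  ⊕-shift-negative : ∀ x j → suc j < N → shift x -[1+ j ] ⊕ suc j ≡ x
  ⊕-shift-negative x j sj<N = begin
    shift x -[1+ j ] ⊕ suc j      ≡⟨ cong (_⊕ suc j) (shift-negative x j sj<N) ⟩
    x ⊕ (N ∸ suc j) ⊕ suc j       ≡⟨ ⊕-assoc x (N ∸ suc j) (suc j) ⟩
    x ⊕ ((N ∸ suc j) + suc j)     ≡⟨ cong (x ⊕_) (ℕ.m∸n+n≡m (ℕ.<⇒≤ sj<N)) ⟩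
    x ⊕ (0 + N)                   ≡⟨ ⊕-period x 0 ⟩
    x ⊕ 0                         ≡⟨ ⊕-identityʳ x ⟩
    x                             ∎
    where open ≡-Reasoning

  shift-negative-⊕ : ∀ b c j → suc j < N → shift (b ⊕ (c + suc j)) -[1+ j ] ≡ b ⊕ c
  shift-negative-⊕ b c j sj<N = begin
    shift (b ⊕ (c + suc j)) -[1+ j ]       ≡⟨ shift-negative (b ⊕ (c + suc j)) j sj<N ⟩
    b ⊕ (c + suc j) ⊕ (N ∸ suc j)          ≡⟨ ⊕-assoc b (c + suc j) (N ∸ suc j) ⟩
    b ⊕ (c + suc j + (N ∸ suc j))          ≡⟨ cong (b ⊕_) (ℕ.+-assoc c (suc j) (N ∸ suc j)) ⟩
    b ⊕ (c + (suc j + (N ∸ suc j)))        ≡⟨ cong (λ k → b ⊕ (c + k)) (ℕ.m+[n∸m]≡n (ℕ.<⇒≤ sj<N)) ⟩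
    b ⊕ (c + N)                            ≡⟨ ⊕-period b c ⟩
    b ⊕ c                                  ∎
    where open ≡-Reasoning

  [u+s]%N<s : ∀ u s → u < N → s ≤ N → N ≤ u + s → (u + s) % N < s
  [u+s]%N<s u s u<N s≤N N≤u+s = begin-strict
    (u + s) % N               ≡⟨ cong (_% N) (ℕ.m∸n+n≡m N≤u+s) ⟨
    (u + s ∸ N + N) % N       ≡⟨ [m+n]%n≡m%n (u + s ∸ N) N ⟩
    (u + s ∸ N) % N           ≡⟨ m<n⇒m%n≡m (ℕ.<-≤-trans u+s∸N<s s≤N) ⟩
    u + s ∸ N                 <⟨ u+s∸N<s ⟩
    s                         ∎
    where
    open ℕ.≤-Reasoning
    u+s∸N<s : u + s ∸ N < s
    u+s∸N<s = subst (u + s ∸ N <_) (ℕ.m+n∸m≡n N s) (ℕ.∸-monoˡ-< (ℕ.+-monoˡ-< s u<N) N≤u+s)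

-- Opened only here, since the ℕ operators of Cyclic have the same names.
open import Data.Rational using (_+_; _*_; _-_; _≤_; _<_)

ℕtoℚ≡mkℚ : ∀ a → ℕtoℚ a ≡ mkℚ (ℤ.+ a) 0 (coprime-sym (1-coprimeTo a))
ℕtoℚ≡mkℚ a = ℚ.normalize-coprime (coprime-sym (1-coprimeTo a))

ℕtoℚ-mono-≤ : ∀ {a b} → a ℕ.≤ b → ℕtoℚ a ≤ ℕtoℚ b
ℕtoℚ-mono-≤ {a} {b} a≤b rewrite ℕtoℚ≡mkℚ a | ℕtoℚ≡mkℚ b =
  *≤* (subst₂ ℤ._≤_ (sym (ℤ.*-identityʳ (ℤ.+ a))) (sym (ℤ.*-identityʳ (ℤ.+ b))) (ℤ.+≤+ a≤b))

ℕtoℚ-+ : ∀ a b → ℕtoℚ (a ℕ.+ b) ≡ ℕtoℚ a + ℕtoℚ b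
ℕtoℚ-+ a b rewrite ℕtoℚ≡mkℚ a | ℕtoℚ≡mkℚ b =
  cong₂ (λ p q → (p ℤ.+ q) ℚ./ 1) (sym (ℤ.*-identityʳ (ℤ.+ a))) (sym (ℤ.*-identityʳ (ℤ.+ b)))

ℕtoℚ-m≤n+o⇒m-n≤o : ∀ {m n o} → m ℕ.≤ n ℕ.+ o → ℕtoℚ m - ℕtoℚ n ≤ ℕtoℚ o
ℕtoℚ-m≤n+o⇒m-n≤o {m} {n} {o} m≤n+o = begin
  ℕtoℚ m - ℕtoℚ n             ≤⟨ ℚ.+-monoˡ-≤ (ℚ.- ℕtoℚ n) (ℕtoℚ-mono-≤ m≤n+o) ⟩
  ℕtoℚ (n ℕ.+ o) - ℕtoℚ n     ≡⟨ cong (_- ℕtoℚ n) (ℕtoℚ-+ n o) ⟩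
  ℕtoℚ n + ℕtoℚ o - ℕtoℚ n    ≡⟨ solve 2 (λ x y → x :+ y :- x := y) refl (ℕtoℚ n) (ℕtoℚ o) ⟩
  ℕtoℚ o                      ∎
  where open ℚ.≤-Reasoning

ℕtoℚ-injective : ∀ {a b} → ℕtoℚ a ≡ ℕtoℚ b → a ≡ b
ℕtoℚ-injective {a} {b} eq rewrite ℕtoℚ≡mkℚ a | ℕtoℚ≡mkℚ b = ℤ.+-injective (cong ℚ.numerator eq)

ℕtoℚ-sum : ∀ (xs : List ℕ) → ℕtoℚ (foldr ℕ._+_ 0 xs) ≡ foldr _+_ 0ℚ (map ℕtoℚ xs)
ℕtoℚ-sum []       = refl
ℕtoℚ-sum (x ∷ xs) = trans (ℕtoℚ-+ x (foldr ℕ._+_ 0 xs)) (cong (ℕtoℚ x +_) (ℕtoℚ-sum xs))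

p<q⇒0<q-p : ∀ {p q} → p < q → 0ℚ < q - p
p<q⇒0<q-p {p} {q} p<q = subst (_< q - p) (ℚ.+-inverseʳ p) (ℚ.+-monoˡ-< (ℚ.- p) p<q)

p≤q⇒0≤q-p : ∀ {p q} → p ≤ q → 0ℚ ≤ q - p
p≤q⇒0≤q-p {p} {q} p≤q = subst (_≤ q - p) (ℚ.+-inverseʳ p) (ℚ.+-monoˡ-≤ (ℚ.- p) p≤q)

p*qinv[p]≡1 : ∀ p → p ≢ 0ℚ → p * qinv p ≡ 1ℚ
p*qinv[p]≡1 p p≢0 with p ℚ.≟ 0ℚ
... | yes p≡0 = contradiction p≡0 p≢0
... | no  p≢0 = ℚ.*-inverseʳ p {{ℚ.≢-nonZero p≢0}}

∑ : ∀ n → (Fin n → ℚ) → ℚ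
∑ n f = foldr _+_ 0ℚ (tabulate f)

sumFin≡∑ : ∀ n f → sumFin n f ≡ ∑ n f
sumFin≡∑ n f = cong (foldr _+_ 0ℚ) (map-tabulate id f)

∑-cong : ∀ n {f g : Fin n → ℚ} → (∀ i → f i ≡ g i) → ∑ n f ≡ ∑ n g
∑-cong n f≗g = cong (foldr _+_ 0ℚ) (tabulate-cong f≗g)

∑-0 : ∀ n → ∑ n (λ _ → 0ℚ) ≡ 0ℚ
∑-0 zero    = refl
∑-0 (suc n) = cong (0ℚ +_) (∑-0 n)

∑-+ : ∀ n (f g : Fin n → ℚ) → ∑ n (λ i → f i + g i) ≡ ∑ n f + ∑ n g
∑-+ zero    f g = refl
∑-+ (suc n) f g = trans (cong (f zero + g zero +_) (∑-+ n (f ∘ suc) (g ∘ suc)))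
  (solve 4 (λ a b c d → (a :+ b) :+ (c :+ d) := (a :+ c) :+ (b :+ d)) refl
    (f zero) (g zero) (∑ n (f ∘ suc)) (∑ n (g ∘ suc)))

∑-- : ∀ n (f g : Fin n → ℚ) → ∑ n (λ i → f i - g i) ≡ ∑ n f - ∑ n g
∑-- zero    f g = refl
∑-- (suc n) f g = trans (cong (f zero - g zero +_) (∑-- n (f ∘ suc) (g ∘ suc)))
  (solve 4 (λ a b c d → (a :- b) :+ (c :- d) := (a :+ c) :- (b :+ d)) refl
    (f zero) (g zero) (∑ n (f ∘ suc)) (∑ n (g ∘ suc)))

∑-*ˡ : ∀ n c (f : Fin n → ℚ) → ∑ n (λ i → c * f i) ≡ c * ∑ n f
∑-*ˡ zero    c f = sym (ℚ.*-zeroʳ c)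
∑-*ˡ (suc n) c f = trans (cong (c * f zero +_) (∑-*ˡ n c (f ∘ suc)))
  (sym (ℚ.*-distribˡ-+ c (f zero) (∑ n (f ∘ suc))))

∑-mono-≤ : ∀ n {f g : Fin n → ℚ} → (∀ i → f i ≤ g i) → ∑ n f ≤ ∑ n g
∑-mono-≤ zero    f≤g = ℚ.≤-refl
∑-mono-≤ (suc n) f≤g = ℚ.+-mono-≤ (f≤g zero) (∑-mono-≤ n (f≤g ∘ suc))

∑-comm : ∀ n m (h : Fin n → Fin m → ℚ) →
         ∑ n (λ i → ∑ m (h i)) ≡ ∑ m (λ j → ∑ n (λ i → h i j))
∑-comm zero    m h = sym (∑-0 m)
∑-comm (suc n) m h = trans (cong (∑ m (h zero) +_) (∑-comm n m (h ∘ suc)))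
  (sym (∑-+ m (h zero) (λ j → ∑ n (λ i → h (suc i) j))))

δ : ∀ {n} → Fin n → Fin n → ℚ
δ a v = if does (v ≟ᶠ a) then 1ℚ else 0ℚ

∑-δ* : ∀ n (a : Fin n) (h : Fin n → ℚ) → ∑ n (λ v → δ a v * h v) ≡ h a
∑-δ* (suc n) zero    h = begin
  1ℚ * h zero + ∑ n (λ v → 0ℚ * h (suc v))  ≡⟨ cong (1ℚ * h zero +_)
                                                  (trans (∑-cong n (λ v → ℚ.*-zeroˡ (h (suc v)))) (∑-0 n)) ⟩
  1ℚ * h zero + 0ℚ                            ≡⟨ solve 1 (λ x → con 1ℚ :* x :+ con 0ℚ := x) refl (h zero) ⟩
  h zero                                      ∎
  where open ≡-Reasoning
∑-δ* (suc n) (suc a) h = trans (cong (0ℚ * h zero +_) (∑-δ* n a (h ∘ suc)))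
  (solve 2 (λ x y → con 0ℚ :* x :+ y := y) refl (h zero) (h (suc a)))

∑-δ : ∀ n (a : Fin n) → ∑ n (δ a) ≡ 1ℚ
∑-δ n a = trans (∑-cong n (λ v → sym (ℚ.*-identityʳ (δ a v)))) (∑-δ* n a (λ _ → 1ℚ))

∑-*δ : ∀ n c (a : Fin n) → ∑ n (λ v → c * δ a v) ≡ c
∑-*δ n c a = trans (∑-*ˡ n c (δ a)) (trans (cong (c *_) (∑-δ n a)) (ℚ.*-identityʳ c))

∑∑-*δδ : ∀ n (a b : Fin n) (H : Fin n → Fin n → ℚ) →
         ∑ n (λ x → ∑ n (λ y → H x y * (δ a x * δ b y))) ≡ H a b
∑∑-*δδ n a b H = begin
  ∑ n (λ x → ∑ n (λ y → H x y * (δ a x * δ b y)))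
    ≡⟨ ∑-cong n (λ x → ∑-cong n (λ y → solve 3 (λ h p q → h :* (p :* q) := p :* (q :* h)) refl
                                         (H x y) (δ a x) (δ b y))) ⟩
  ∑ n (λ x → ∑ n (λ y → δ a x * (δ b y * H x y)))
    ≡⟨ ∑-cong n (λ x → trans (∑-*ˡ n (δ a x) _) (cong (δ a x *_) (∑-δ* n b (H x)))) ⟩
  ∑ n (λ x → δ a x * H x b)
    ≡⟨ ∑-δ* n a (λ x → H x b) ⟩
  H a b
    ∎
  where open ≡-Reasoning

module _ {n : ℕ} where

  ⟦_⟧ : List (ℚ × Fin n) → Fin n → ℚ
  ⟦ [] ⟧          v = 0ℚ
  ⟦ (w , a) ∷ ws ⟧ v = w * δ a v + ⟦ ws ⟧ v

  weightedSum : (Fin n → ℚ) → List (ℚ × Fin n) → ℚ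
  weightedSum h []             = 0ℚ
  weightedSum h ((w , a) ∷ ws) = w * h a + weightedSum h ws

  ∑-*⟦⟧ : ∀ (h : Fin n → ℚ) ws → ∑ n (λ v → h v * ⟦ ws ⟧ v) ≡ weightedSum h ws
  ∑-*⟦⟧ h []             = trans (∑-cong n (λ v → ℚ.*-zeroʳ (h v))) (∑-0 n)
  ∑-*⟦⟧ h ((w , a) ∷ ws) = begin
    ∑ n (λ v → h v * (w * δ a v + ⟦ ws ⟧ v))
      ≡⟨ ∑-cong n (λ v → solve 4 (λ x w d m → x :* (w :* d :+ m) := w :* (d :* x) :+ x :* m) refl
                           (h v) w (δ a v) (⟦ ws ⟧ v)) ⟩
    ∑ n (λ v → w * (δ a v * h v) + h v * ⟦ ws ⟧ v)
      ≡⟨ ∑-+ n _ _ ⟩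
    ∑ n (λ v → w * (δ a v * h v)) + ∑ n (λ v → h v * ⟦ ws ⟧ v)
      ≡⟨ cong₂ _+_ (trans (∑-*ˡ n w _) (cong (w *_) (∑-δ* n a h))) (∑-*⟦⟧ h ws) ⟩
    w * h a + weightedSum h ws
      ∎
    where open ≡-Reasoning

  _∈ᵇ_ : Fin n → List (Fin n) → Bool
  z ∈ᵇ as = any (λ a → does (z ≟ᶠ a)) as

  ∉⇒⟦uniform⟧≡0 : ∀ {z as} c → All (z ≢_) as → ⟦ map (c ,_) as ⟧ z ≡ 0ℚ
  ∉⇒⟦uniform⟧≡0 c [] = refl
  ∉⇒⟦uniform⟧≡0 {z} c (_∷_ {a} z≢a z∉as) with z ≟ᶠ a
  ... | yes z≡a = contradiction z≡a z≢a
  ... | no  _   = trans (cong (c * 0ℚ +_) (∉⇒⟦uniform⟧≡0 c z∉as))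
                    (solve 1 (λ x → x :* con 0ℚ :+ con 0ℚ := con 0ℚ) refl c)

  if-∈ᵇ≡⟦uniform⟧ : ∀ {as} → Unique as → ∀ c z →
                    (if z ∈ᵇ as then c else 0ℚ) ≡ ⟦ map (c ,_) as ⟧ z
  if-∈ᵇ≡⟦uniform⟧ []               c z = refl
  if-∈ᵇ≡⟦uniform⟧ (_∷_ {a} {as} a∉as u) c z with z ≟ᶠ a
  ... | yes refl rewrite ∉⇒⟦uniform⟧≡0 c a∉as = solve 1 (λ x → x := x :* con 1ℚ :+ con 0ℚ) refl c
  ... | no  _    = trans (if-∈ᵇ≡⟦uniform⟧ u c z)
                      (solve 2 (λ x m → m := x :* con 0ℚ :+ m) refl c (⟦ map (c ,_) as ⟧ z))

module _ {n : ℕ} where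

  -- (w , a , b , ℓ) moves mass w from a to b along a path of length ℓ.
  Move : Set
  Move = ℚ × Fin n × Fin n × ℕ

  plan : List Move → Fin n → Fin n → ℚ
  plan []                    x y = 0ℚ
  plan ((w , a , b , _) ∷ P) x y = w * (δ a x * δ b y) + plan P x y

  sources targets : List Move → List (ℚ × Fin n)
  sources = map (λ (w , a , _ , _) → w , a)
  targets = map (λ (w , _ , b , _) → w , b)

  mass : List Move → ℚ
  mass []                    = 0ℚ
  mass ((w , _ , _ , _) ∷ P) = w + mass P

  planCost : List Move → ℚ
  planCost []                    = 0ℚ
  planCost ((w , _ , _ , ℓ) ∷ P) = w * ℕtoℚ ℓ + planCost P

  ∑-plan-row : ∀ P x → ∑ n (plan P x) ≡ ⟦ sources P ⟧ x
  ∑-plan-row []                    x = ∑-0 n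
  ∑-plan-row ((w , a , b , _) ∷ P) x = trans (∑-+ n _ (plan P x)) (cong₂ _+_
    (trans (∑-cong n (λ y → sym (ℚ.*-assoc w (δ a x) (δ b y)))) (∑-*δ n (w * δ a x) b))
    (∑-plan-row P x))

  ∑-plan-col : ∀ P y → ∑ n (λ x → plan P x y) ≡ ⟦ targets P ⟧ y
  ∑-plan-col []                    y = ∑-0 n
  ∑-plan-col ((w , a , b , _) ∷ P) y = trans (∑-+ n _ (λ x → plan P x y)) (cong₂ _+_
    (trans (∑-cong n (λ x → solve 3 (λ w p q → w :* (p :* q) := (w :* q) :* p) refl w (δ a x) (δ b y)))
           (∑-*δ n (w * δ b y) a))
    (∑-plan-col P y))

  ∑∑-*plan : ∀ D P → All (λ (_ , a , b , ℓ) → D a b ≡ ℕtoℚ ℓ) P →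
             ∑ n (λ x → ∑ n (λ y → D x y * plan P x y)) ≡ planCost P
  ∑∑-*plan D [] [] = trans (∑-cong n (λ x → trans (∑-cong n (λ y → ℚ.*-zeroʳ (D x y))) (∑-0 n))) (∑-0 n)
  ∑∑-*plan D ((w , a , b , ℓ) ∷ P) (Dab≡ℓ ∷ lengths) = begin
    ∑ n (λ x → ∑ n (λ y → D x y * (w * (δ a x * δ b y) + plan P x y)))
      ≡⟨ ∑-cong n (λ x → trans (∑-cong n (λ y → distrib (D x y) (δ a x * δ b y) (plan P x y))) (∑-+ n _ _)) ⟩
    ∑ n (λ x → ∑ n (λ y → w * (D x y * (δ a x * δ b y))) + ∑ n (λ y → D x y * plan P x y))
      ≡⟨ ∑-+ n _ _ ⟩
    ∑ n (λ x → ∑ n (λ y → w * (D x y * (δ a x * δ b y)))) + ∑ n (λ x → ∑ n (λ y → D x y * plan P x y))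
      ≡⟨ cong₂ _+_ move-cost (∑∑-*plan D P lengths) ⟩
    w * ℕtoℚ ℓ + planCost P
      ∎
    where
    open ≡-Reasoning
    distrib : ∀ d e r → d * (w * e + r) ≡ w * (d * e) + d * r
    distrib = solve 4 (λ w d e r → d :* (w :* e :+ r) := w :* (d :* e) :+ d :* r) refl w
    move-cost : ∑ n (λ x → ∑ n (λ y → w * (D x y * (δ a x * δ b y)))) ≡ w * ℕtoℚ ℓ
    move-cost = begin
      ∑ n (λ x → ∑ n (λ y → w * (D x y * (δ a x * δ b y))))   ≡⟨ ∑-cong n (λ x → ∑-*ˡ n w _) ⟩
      ∑ n (λ x → w * ∑ n (λ y → D x y * (δ a x * δ b y)))     ≡⟨ ∑-*ˡ n w _ ⟩
      w * ∑ n (λ x → ∑ n (λ y → D x y * (δ a x * δ b y)))     ≡⟨ cong (w *_) (trans (∑∑-*δδ n a b D) Dab≡ℓ) ⟩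
      w * ℕtoℚ ℓ                                               ∎

  δ*δ-nonNeg : ∀ (a b x y : Fin n) → 0ℚ ≤ δ a x * δ b y
  δ*δ-nonNeg a b x y with does (x ≟ᶠ a) | does (y ≟ᶠ b)
  ... | true  | true  = ℚ.nonNegative⁻¹ 1ℚ
  ... | true  | false = ℚ.≤-refl
  ... | false | true  = ℚ.≤-refl
  ... | false | false = ℚ.≤-refl

  δ*δ≤1 : ∀ (a b x y : Fin n) → δ a x * δ b y ≤ 1ℚ
  δ*δ≤1 a b x y with does (x ≟ᶠ a) | does (y ≟ᶠ b)
  ... | true  | true  = ℚ.≤-refl
  ... | true  | false = ℚ.nonNegative⁻¹ 1ℚ
  ... | false | true  = ℚ.nonNegative⁻¹ 1ℚ
  ... | false | false = ℚ.nonNegative⁻¹ 1ℚ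

  NonNegWeights : List Move → Set
  NonNegWeights = All (λ (w , _ , _ , _) → 0ℚ ≤ w)

  plan-nonNeg : ∀ {P} → NonNegWeights P → ∀ x y → 0ℚ ≤ plan P x y
  plan-nonNeg [] x y = ℚ.≤-refl
  plan-nonNeg (_∷_ {w , a , b , _} 0≤w ws) x y = ℚ.+-mono-≤ 0≤w·δδ (plan-nonNeg ws x y)
    where
    0≤w·δδ : 0ℚ ≤ w * (δ a x * δ b y)
    0≤w·δδ = ℚ.nonNegative⁻¹ _ {{ℚ.nonNeg*nonNeg⇒nonNeg w {{ℚ.nonNegative 0≤w}} _
                                   {{ℚ.nonNegative (δ*δ-nonNeg a b x y)}}}}

  plan≤mass : ∀ {P} → NonNegWeights P → ∀ x y → plan P x y ≤ mass P
  plan≤mass [] x y = ℚ.≤-refl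
  plan≤mass (_∷_ {w , a , b , _} 0≤w ws) x y = ℚ.+-mono-≤ w·δδ≤w (plan≤mass ws x y)
    where
    w·δδ≤w : w * (δ a x * δ b y) ≤ w
    w·δδ≤w = ℚ.≤-trans (ℚ.*-monoˡ-≤-nonNeg w {{ℚ.nonNegative 0≤w}} (δ*δ≤1 a b x y))
                       (ℚ.≤-reflexive (ℚ.*-identityʳ w))

  plan-isCoupling : ∀ {P m₁ m₂} → NonNegWeights P → mass P ≡ 1ℚ →
                    (∀ x → ⟦ sources P ⟧ x ≡ m₁ x) → (∀ y → ⟦ targets P ⟧ y ≡ m₂ y) →
                    IsCoupling m₁ m₂ (plan P)
  plan-isCoupling {P} ws mass≡1 src tgt =
      plan-nonNeg ws
    , (λ x y → ℚ.≤-trans (plan≤mass ws x y) (ℚ.≤-reflexive mass≡1))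
    , (λ x → trans (sumFin≡∑ n (plan P x)) (trans (∑-plan-row P x) (src x)))
    , (λ y → trans (sumFin≡∑ n (λ x → plan P x y)) (trans (∑-plan-col P y) (tgt y)))

-- Graph distance and Kantorovich duality

firstTrue-≡0 : ∀ fuel p → 0 ℕ.< fuel → T (p 0) → firstTrue fuel p ≡ 0
firstTrue-≡0 (suc fuel) p _ p0 rewrite Equivalence.to T-≡ p0 = refl

firstTrue-≡1 : ∀ fuel p → 1 ℕ.< fuel → p 0 ≡ false → T (p 1) → firstTrue fuel p ≡ 1
firstTrue-≡1 (suc (suc fuel)) p _ ¬p0 p1 rewrite ¬p0 | Equivalence.to T-≡ p1 = refl
firstTrue-≡1 (suc zero) p (s≤s ()) _ _

firstTrue-spec : ∀ fuel p → T (p (firstTrue fuel p)) ⊎ firstTrue fuel p ≡ fuel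
firstTrue-spec zero       p = inj₂ refl
firstTrue-spec (suc fuel) p with p zero in p0
... | true  = inj₁ (Equivalence.from T-≡ p0)
... | false with firstTrue-spec fuel (p ∘ suc)
...   | inj₁ found = inj₁ found
...   | inj₂ none  = inj₂ (cong suc none)

distinct⇒1<n : ∀ {n} {x y : Fin n} → x ≢ y → 1 ℕ.< n
distinct⇒1<n {suc zero}    {zero} {zero} x≢y = contradiction refl x≢y
distinct⇒1<n {suc (suc n)}               _   = s≤s (s≤s z≤n)

T-≟⇒≡ : ∀ {n} {x y : Fin n} → T (does (x ≟ᶠ y)) → x ≡ y
T-≟⇒≡ {x = x} {y} x≟y with x ≟ᶠ y
... | yes x≡y = x≡y

T-≟-refl : ∀ {n} (x : Fin n) → T (does (x ≟ᶠ x))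
T-≟-refl x = Equivalence.from T-≡ (dec-true (x ≟ᶠ x) refl)

module _ {n : ℕ} (G : Graph n) where

  Lipschitz : (Fin n → ℕ) → Set
  Lipschitz f = ∀ x z → T (G x z) → f x ℕ.≤ suc (f z)

  ≤1⇒Lipschitz : ∀ {f} → (∀ v → f v ℕ.≤ 1) → Lipschitz f
  ≤1⇒Lipschitz f≤1 x z _ = ℕ.≤-trans (f≤1 x) (s≤s z≤n)

  within-Lipschitz : ∀ {f} → Lipschitz f → ∀ k x y → T (within G k x y) → f x ℕ.≤ f y ℕ.+ k
  within-Lipschitz {f} L zero x y x≟y with refl ← T-≟⇒≡ {x = x} {y} x≟y = ℕ.m≤m+n (f y) 0
  within-Lipschitz {f} L (suc k) x y walk with Equivalence.to T-∨ walk
  ... | inj₁ short = ℕ.≤-trans (within-Lipschitz L k x y short) (ℕ.+-monoʳ-≤ (f y) (ℕ.n≤1+n k))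
  ... | inj₂ step with satisfied (any⁻ _ (allFin n) step)
  ... | z , xz∧zy with Equivalence.to T-∧ xz∧zy
  ... | xz , zy = begin
    f x                 ≤⟨ L x z xz ⟩
    suc (f z)           ≤⟨ s≤s (within-Lipschitz L k z y zy) ⟩
    suc (f y ℕ.+ k)     ≡⟨ ℕ.+-suc (f y) k ⟨
    f y ℕ.+ suc k       ∎
    where open ℕ.≤-Reasoning

  -- When no walk is found, dist returns its fuel n; the bound on f covers that case.
  Lipschitz⇒≤dist : ∀ {f} → Lipschitz f → (∀ v → f v ℕ.≤ n) → ∀ x y → f x ℕ.≤ f y ℕ.+ dist G x y
  Lipschitz⇒≤dist {f} L f≤n x y with firstTrue-spec n (λ k → within G k x y)
  ... | inj₁ walk = within-Lipschitz L _ x y walk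
  ... | inj₂ none rewrite none = ℕ.≤-trans (f≤n x) (ℕ.m≤n+m n (f y))

  dist-refl : ∀ x → dist G x x ≡ 0
  dist-refl x = firstTrue-≡0 n (λ k → within G k x x) (ℕ.≤-<-trans z≤n (toℕ<n x))
                  (T-≟-refl x)

  dist-adjacent : ∀ {x y} → x ≢ y → T (G x y) → dist G x y ≡ 1
  dist-adjacent {x} {y} x≢y xy = firstTrue-≡1 n (λ k → within G k x y) (distinct⇒1<n x≢y)
    (dec-false (x ≟ᶠ y) x≢y)
    (Equivalence.from T-∨ (inj₂ (any⁺ _ (lose (∈-allFin y)
      (Equivalence.from T-∧ (xy , T-≟-refl y))))))

  ℕtoℚ-deg : ∀ x → ℕtoℚ (deg G x) ≡ ∑ n (λ z → if G x z then 1ℚ else 0ℚ)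
  ℕtoℚ-deg x = begin
    ℕtoℚ (deg G x)                                          ≡⟨ ℕtoℚ-sum (map indicator (allFin n)) ⟩
    foldr _+_ 0ℚ (map ℕtoℚ (map indicator (allFin n)))     ≡⟨ cong (foldr _+_ 0ℚ) (map-∘ (allFin n)) ⟨
    sumFin n (ℕtoℚ ∘ indicator)                             ≡⟨ sumFin≡∑ n _ ⟩
    ∑ n (ℕtoℚ ∘ indicator)                                  ≡⟨ ∑-cong n (λ z → ℕtoℚ-if (G x z)) ⟩
    ∑ n (λ z → if G x z then 1ℚ else 0ℚ)                    ∎
    where
    open ≡-Reasoning
    indicator : Fin n → ℕ
    indicator z = if G x z then 1 else 0
    ℕtoℚ-if : ∀ b → ℕtoℚ (if b then 1 else 0) ≡ (if b then 1ℚ else 0ℚ)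
    ℕtoℚ-if true  = refl
    ℕtoℚ-if false = refl

  cost≡∑∑ : ∀ π → cost G π ≡ ∑ n (λ x → ∑ n (λ y → ℕtoℚ (dist G x y) * π x y))
  cost≡∑∑ π = trans (sumFin≡∑ n _) (∑-cong n (λ x → sumFin≡∑ n _))

  cost-plan : ∀ P → All (λ (_ , a , b , ℓ) → dist G a b ≡ ℓ) P → cost G (plan P) ≡ planCost P
  cost-plan P lengths = trans (cost≡∑∑ (plan P)) (∑∑-*plan _ P (All.map (cong ℕtoℚ) lengths))

  Lipschitz⇒gap≤cost : ∀ {f} → Lipschitz f → (∀ v → f v ℕ.≤ n) →
    ∀ {m₁ m₂ π} → IsCoupling m₁ m₂ π →
    ∑ n (λ x → ℕtoℚ (f x) * m₁ x) - ∑ n (λ y → ℕtoℚ (f y) * m₂ y) ≤ cost G π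
  Lipschitz⇒gap≤cost {f} L f≤n {m₁} {m₂} {π} (π≥0 , _ , row , col) = begin
    ∑ n (λ x → F x * m₁ x) - ∑ n (λ y → F y * m₂ y)
      ≡⟨ cong₂ _-_ (∑-cong n (λ x → cong (F x *_) (sym (row′ x))))
                   (∑-cong n (λ y → cong (F y *_) (sym (col′ y)))) ⟩
    ∑ n (λ x → F x * ∑ n (π x)) - ∑ n (λ y → F y * ∑ n (λ x → π x y))
      ≡⟨ cong₂ _-_ (∑-cong n (λ x → sym (∑-*ˡ n (F x) (π x))))
                   (trans (∑-cong n (λ y → sym (∑-*ˡ n (F y) (λ x → π x y))))
                          (sym (∑-comm n n (λ x y → F y * π x y)))) ⟩
    ∑ n (λ x → ∑ n (λ y → F x * π x y)) - ∑ n (λ x → ∑ n (λ y → F y * π x y))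
      ≡⟨ sym (trans (∑-cong n (λ x → ∑-- n _ _)) (∑-- n _ _)) ⟩
    ∑ n (λ x → ∑ n (λ y → F x * π x y - F y * π x y))
      ≤⟨ ∑-mono-≤ n (λ x → ∑-mono-≤ n (λ y → transport-bound x y)) ⟩
    ∑ n (λ x → ∑ n (λ y → ℕtoℚ (dist G x y) * π x y))
      ≡⟨ cost≡∑∑ π ⟨
    cost G π
      ∎
    where
    open ℚ.≤-Reasoning
    F : Fin n → ℚ
    F x = ℕtoℚ (f x)
    row′ : ∀ x → ∑ n (π x) ≡ m₁ x
    row′ x = trans (sym (sumFin≡∑ n (π x))) (row x)
    col′ : ∀ y → ∑ n (λ x → π x y) ≡ m₂ y
    col′ y = trans (sym (sumFin≡∑ n _)) (col y)
    transport-bound : ∀ x y → F x * π x y - F y * π x y ≤ ℕtoℚ (dist G x y) * π x y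
    transport-bound x y = begin
      F x * π x y - F y * π x y       ≡⟨ solve 3 (λ a b p → a :* p :- b :* p := (a :- b) :* p) refl
                                               (F x) (F y) (π x y) ⟩
      (F x - F y) * π x y             ≤⟨ ℚ.*-monoʳ-≤-nonNeg (π x y) {{ℚ.nonNegative (π≥0 x y)}}
                                           (ℕtoℚ-m≤n+o⇒m-n≤o {f x} {f y} (Lipschitz⇒≤dist L f≤n x y)) ⟩
      ℕtoℚ (dist G x y) * π x y       ∎

  IsW1-by-duality : ∀ {m₁ m₂ w} f → Lipschitz f → (∀ v → f v ℕ.≤ n) →
    ∑ n (λ x → ℕtoℚ (f x) * m₁ x) - ∑ n (λ y → ℕtoℚ (f y) * m₂ y) ≡ w →
    ∀ π → IsCoupling m₁ m₂ π → cost G π ≡ w → IsW1 G m₁ m₂ w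
  IsW1-by-duality {w = w} f L f≤n gap≡w π π-coupling cost≡w =
      (λ π′ π′-coupling → ℚ.≤-trans (ℚ.≤-reflexive (sym gap≡w))
                                    (Lipschitz⇒gap≤cost L f≤n π′-coupling))
    , (λ ε ε>0 → π , π-coupling ,
         ℚ.≤-<-trans (ℚ.≤-reflexive (trans cost≡w (sym (ℚ.+-identityʳ w)))) (ℚ.+-monoʳ-< w ε>0))

IsRicci-by-exact : ∀ {n} (G : Graph n) x y c →
  (∀ α → ½ ≤ α → α < 1ℚ →
     ∃ λ W → IsW1 G (μ G α x) (μ G α y) W × κα G x y W * qinv (1ℚ - α) ≡ c) →
  IsRicci G x y c
IsRicci-by-exact G x y c exact ε ε>0 = ½ , ℚ.positive⁻¹ ½ , λ α _ α<1 ½<α →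
  let W , isW1 , κ≡c = exact α (ℚ.<⇒≤ ½<α) α<1 in
  W , isW1 , subst (_< ε) (sym (trans (cong (λ k → ∣ k - c ∣) κ≡c) (cong ∣_∣ (ℚ.+-inverseʳ c)))) ε>0

IsRicci-by-W₁ : ∀ {n} (G : Graph n) x y t → dist G x y ≡ 1 →
  (∀ α → ½ ≤ α → α < 1ℚ → IsW1 G (μ G α x) (μ G α y) (α + (1ℚ - α) * t)) →
  IsRicci G x y (1ℚ - t)
IsRicci-by-W₁ G x y t d≡1 W₁≡ =
  IsRicci-by-exact G x y (1ℚ - t) (λ α ½≤α α<1 → _ , W₁≡ α ½≤α α<1 , κ≡1-t α α<1)
  where
  open ≡-Reasoning
  κ≡1-t : ∀ α → α < 1ℚ → κα G x y (α + (1ℚ - α) * t) * qinv (1ℚ - α) ≡ 1ℚ - t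
  κ≡1-t α α<1 = begin
    κα G x y W * qinv (1ℚ - α)               ≡⟨ cong (λ d → (1ℚ - W * qinv (ℕtoℚ d)) * qinv (1ℚ - α)) d≡1 ⟩
    (1ℚ - W * qinv 1ℚ) * qinv (1ℚ - α)       ≡⟨ cong (_* qinv (1ℚ - α)) 1-W≡ ⟩
    (1ℚ - t) * (1ℚ - α) * qinv (1ℚ - α)      ≡⟨ ℚ.*-assoc (1ℚ - t) (1ℚ - α) _ ⟩
    (1ℚ - t) * ((1ℚ - α) * qinv (1ℚ - α))    ≡⟨ cong ((1ℚ - t) *_) (p*qinv[p]≡1 (1ℚ - α) 1-α≢0) ⟩
    (1ℚ - t) * 1ℚ                            ≡⟨ ℚ.*-identityʳ (1ℚ - t) ⟩
    1ℚ - t                                   ∎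
    where
    W = α + (1ℚ - α) * t
    1-W≡ : 1ℚ - W * qinv 1ℚ ≡ (1ℚ - t) * (1ℚ - α)
    1-W≡ = solve 2 (λ a t → con 1ℚ :- (a :+ (con 1ℚ :- a) :* t) :* con (qinv 1ℚ)
                          := (con 1ℚ :- t) :* (con 1ℚ :- a)) refl α t
    1-α≢0 : 1ℚ - α ≢ 0ℚ
    1-α≢0 = ≢-sym (ℚ.<⇒≢ (p<q⇒0<q-p α<1))

module CayleyS₁₃ (N : ℕ) .{{_ : NonZero N}} (16≤N : 16 ℕ.≤ N) where

  open Cyclic N

  Γ : Graph N
  Γ = cayley N S₁₃

  -- In the order of S₁₃, so that Γ x z is definitionally z ∈ᵇ neighbours x.
  neighbours : Fin N → List (Fin N)
  neighbours x = x ⊕ 1 ∷ shift x -[1+ 0 ] ∷ x ⊕ 3 ∷ shift x -[1+ 2 ] ∷ []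

  ≤15⇒<N : ∀ c → c ℕ.≤ 15 → c ℕ.< N
  ≤15⇒<N c c≤15 = ℕ.≤-trans (s≤s c≤15) 16≤N

  private
    1<N : 1 ℕ.< N
    1<N = ≤15⇒<N 1 (s≤s z≤n)
    3<N : 3 ℕ.< N
    3<N = ≤15⇒<N 3 (s≤s (s≤s (s≤s z≤n)))
    3<N∸3 : 3 ℕ.< N ℕ.∸ 3
    3<N∸3 = ℕ.∸-monoˡ-≤ 3 (ℕ.≤-trans (ℕ.m≤m+n 7 9) 16≤N)
    N∸3<N∸1 : N ℕ.∸ 3 ℕ.< N ℕ.∸ 1
    N∸3<N∸1 = ℕ.∸-monoʳ-< (s≤s (s≤s z≤n)) (ℕ.<⇒≤ 3<N)
    N∸1<N : N ℕ.∸ 1 ℕ.< N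
    N∸1<N = ℕ.∸-monoʳ-< (s≤s z≤n) (ℕ.<⇒≤ 1<N)

  neighbours-offsets : ∀ x → neighbours x ≡ x ⊕ 1 ∷ x ⊕ (N ℕ.∸ 1) ∷ x ⊕ 3 ∷ x ⊕ (N ℕ.∸ 3) ∷ []
  neighbours-offsets x =
    cong₂ (λ y y′ → x ⊕ 1 ∷ y ∷ x ⊕ 3 ∷ y′ ∷ []) (shift-negative x 0 1<N) (shift-negative x 2 3<N)

  neighbours-unique : ∀ x → Unique (x ∷ neighbours x)
  neighbours-unique x = subst Unique (cong₂ _∷_ (⊕-identityʳ x) (sym (neighbours-offsets x)))
    ( (apart 0<1 1<N ∷ apart 0<N∸1 N∸1<N ∷ apart 0<3 3<N ∷ apart 0<N∸3 N∸3<N ∷ [])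
    ∷ (apart 1<N∸1 N∸1<N ∷ apart 1<3 3<N ∷ apart 1<N∸3 N∸3<N ∷ [])
    ∷ (≢-sym (apart 3<N∸1 N∸1<N) ∷ ≢-sym (apart N∸3<N∸1 N∸1<N) ∷ [])
    ∷ (apart 3<N∸3 N∸3<N ∷ [])
    ∷ [] ∷ [])
    where
    apart : ∀ {o o′} → o ℕ.< o′ → o′ ℕ.< N → x ⊕ o ≢ x ⊕ o′
    apart o<o′ o′<N eq = ℕ.<⇒≢ o<o′ (⊕-cancelˡ x (ℕ.<-trans o<o′ o′<N) o′<N eq)
    0<1 : 0 ℕ.< 1
    0<1 = s≤s z≤n
    1<3 : 1 ℕ.< 3
    1<3 = s≤s (s≤s z≤n)
    0<3 : 0 ℕ.< 3
    0<3 = ℕ.<-trans 0<1 1<3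
    1<N∸3 : 1 ℕ.< N ℕ.∸ 3
    1<N∸3 = ℕ.<-trans 1<3 3<N∸3
    0<N∸3 : 0 ℕ.< N ℕ.∸ 3
    0<N∸3 = ℕ.<-trans 0<1 1<N∸3
    3<N∸1 : 3 ℕ.< N ℕ.∸ 1
    3<N∸1 = ℕ.<-trans 3<N∸3 N∸3<N∸1
    1<N∸1 : 1 ℕ.< N ℕ.∸ 1
    1<N∸1 = ℕ.<-trans 1<3 3<N∸1
    0<N∸1 : 0 ℕ.< N ℕ.∸ 1
    0<N∸1 = ℕ.<-trans 0<1 1<N∸1
    N∸3<N : N ℕ.∸ 3 ℕ.< N
    N∸3<N = ℕ.<-trans N∸3<N∸1 N∸1<N

  Γ-step : ∀ {x z} → T (Γ x z) → ∃ λ s → s ℕ.≤ 3 × (z ≡ x ⊕ s ⊎ x ≡ z ⊕ s)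
  Γ-step {x} {z} xz with any⁻ (λ a → does (z ≟ᶠ a)) (neighbours x) xz
  ... | here z≟x+1                         = 1 , s≤s z≤n , inj₁ (T-≟⇒≡ z≟x+1)
  ... | there (here z≟x-1)                 = 1 , s≤s z≤n ,
          inj₂ (subst (λ y → x ≡ y ⊕ 1) (sym (T-≟⇒≡ z≟x-1)) (sym (⊕-shift-negative x 0 1<N)))
  ... | there (there (here z≟x+3))         = 3 , ℕ.≤-refl , inj₁ (T-≟⇒≡ z≟x+3)
  ... | there (there (there (here z≟x-3))) = 3 , ℕ.≤-refl ,
          inj₂ (subst (λ y → x ≡ y ⊕ 3) (sym (T-≟⇒≡ z≟x-3)) (sym (⊕-shift-negative x 2 3<N)))

  -- A step of length ≤ 3 that wraps around the cycle joins an offset ≥ N ∸ 3 to one < 3,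
  -- where φ ≤ 1.
  module _ (φ : ℕ → ℕ)
           (coarse : ∀ r s → s ℕ.≤ 3 → φ r ℕ.≤ suc (φ (r ℕ.+ s)) × φ (r ℕ.+ s) ℕ.≤ suc (φ r))
           (edge : ∀ r → r ℕ.< 3 ⊎ N ℕ.∸ 3 ℕ.≤ r → φ r ℕ.≤ 1) where

    windowed-step : ∀ u s → u ℕ.< N → s ℕ.≤ 3 →
                    φ u ℕ.≤ suc (φ ((u ℕ.+ s) ℕ.% N)) × φ ((u ℕ.+ s) ℕ.% N) ℕ.≤ suc (φ u)
    windowed-step u s u<N s≤3 with u ℕ.+ s ℕ.<? N
    ... | yes u+s<N rewrite m<n⇒m%n≡m u+s<N = coarse u s s≤3
    ... | no  u+s≮N = ℕ.≤-trans (edge u (inj₂ N∸3≤u)) (s≤s z≤n) , ℕ.≤-trans (edge _ (inj₁ wrapped<3)) (s≤s z≤n)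
      where
      N≤u+s : N ℕ.≤ u ℕ.+ s
      N≤u+s = ℕ.≮⇒≥ u+s≮N
      N∸3≤u : N ℕ.∸ 3 ℕ.≤ u
      N∸3≤u = ℕ.≤-trans (ℕ.∸-monoʳ-≤ N s≤3)
                        (ℕ.m≤n+o⇒m∸n≤o N s (subst (N ℕ.≤_) (ℕ.+-comm u s) N≤u+s))
      wrapped<3 : (u ℕ.+ s) ℕ.% N ℕ.< 3
      wrapped<3 = ℕ.<-≤-trans ([u+s]%N<s u s u<N (ℕ.≤-trans s≤3 (ℕ.<⇒≤ 3<N)) N≤u+s) s≤3

    windowed-Lipschitz : ∀ b → Lipschitz Γ (φ ∘ offset b)
    windowed-Lipschitz b x z xz with Γ-step {x} {z} xz
    ... | s , s≤3 , inj₁ refl rewrite offset-⊕ b x s =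
      proj₁ (windowed-step (offset b x) s (offset<N b x) s≤3)
    ... | s , s≤3 , inj₂ refl rewrite offset-⊕ b z s =
      proj₂ (windowed-step (offset b z) s (offset<N b z) s≤3)

  deg-Γ : ∀ x → deg Γ x ≡ 4
  deg-Γ x with neighbours-unique x
  ... | _ ∷ unique = ℕtoℚ-injective (begin
    ℕtoℚ (deg Γ x)                                    ≡⟨ ℕtoℚ-deg Γ x ⟩
    ∑ N (λ z → if z ∈ᵇ neighbours x then 1ℚ else 0ℚ)  ≡⟨ ∑-cong N (if-∈ᵇ≡⟦uniform⟧ unique 1ℚ) ⟩
    ∑ N ⟦ ones ⟧                                      ≡⟨ ∑-cong N (λ z → ℚ.*-identityˡ (⟦ ones ⟧ z)) ⟨
    ∑ N (λ z → 1ℚ * ⟦ ones ⟧ z)                       ≡⟨ ∑-*⟦⟧ (λ _ → 1ℚ) ones ⟩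
    ℕtoℚ 4                                            ∎)
    where
    open ≡-Reasoning
    ones = map (1ℚ ,_) (neighbours x)

  spread : ℚ → ℚ
  spread α = (1ℚ - α) * qinv (ℕtoℚ 4)

  spread-nonNeg : ∀ α → α < 1ℚ → 0ℚ ≤ spread α
  spread-nonNeg α α<1 = ℚ.≤-trans (ℚ.≤-reflexive (sym (ℚ.*-zeroˡ (qinv (ℕtoℚ 4)))))
    (ℚ.*-monoʳ-≤-nonNeg (qinv (ℕtoℚ 4)) (ℚ.<⇒≤ (p<q⇒0<q-p α<1)))

  μ-Γ : ∀ α x v → μ Γ α x v ≡ ⟦ (α , x) ∷ map (spread α ,_) (neighbours x) ⟧ v
  μ-Γ α x v with neighbours-unique x
  ... | x∉ ∷ unique rewrite deg-Γ x with x ≟ᶠ v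
  ...   | yes refl rewrite dec-true (x ≟ᶠ x) refl | ∉⇒⟦uniform⟧≡0 (spread α) x∉ =
          solve 1 (λ a → a := a :* con 1ℚ :+ con 0ℚ) refl α
  ...   | no  x≢v  rewrite dec-false (v ≟ᶠ x) (≢-sym x≢v) =
          trans (if-∈ᵇ≡⟦uniform⟧ unique (spread α) v)
                (solve 2 (λ a m → m := a :* con 0ℚ :+ m) refl α (⟦ map (spread α ,_) (neighbours x) ⟧ v))

  neighbours-⊕ : ∀ b c → 3 ℕ.≤ c →
    neighbours (b ⊕ c) ≡ b ⊕ (c ℕ.+ 1) ∷ b ⊕ (c ℕ.∸ 1) ∷ b ⊕ (c ℕ.+ 3) ∷ b ⊕ (c ℕ.∸ 3) ∷ []
  neighbours-⊕ b c 3≤c =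
    cong₂ _∷_ (⊕-assoc b c 1) (cong₂ _∷_ (back 0 (s≤s z≤n) (ℕ.≤-trans (s≤s z≤n) 3≤c))
      (cong₂ _∷_ (⊕-assoc b c 3) (cong (_∷ []) (back 2 ℕ.≤-refl 3≤c))))
    where
    back : ∀ j → suc j ℕ.≤ 3 → suc j ℕ.≤ c → shift (b ⊕ c) -[1+ j ] ≡ b ⊕ (c ℕ.∸ suc j)
    back j sj≤3 sj≤c = begin
      shift (b ⊕ c) -[1+ j ]                          ≡⟨ cong (λ k → shift (b ⊕ k) -[1+ j ]) (ℕ.m∸n+n≡m sj≤c) ⟨
      shift (b ⊕ (c ℕ.∸ suc j ℕ.+ suc j)) -[1+ j ]     ≡⟨ shift-negative-⊕ b (c ℕ.∸ suc j) j
                                                            (≤15⇒<N (suc j) (ℕ.≤-trans sj≤3 (ℕ.m≤m+n 3 12))) ⟩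
      b ⊕ (c ℕ.∸ suc j)                               ∎
      where open ≡-Reasoning

  μ-atoms : ℚ → Fin N → ℕ → List (ℚ × Fin N)
  μ-atoms α b c = (α , b ⊕ c) ∷ (spread α , b ⊕ (c ℕ.+ 1)) ∷ (spread α , b ⊕ (c ℕ.∸ 1))
                ∷ (spread α , b ⊕ (c ℕ.+ 3)) ∷ (spread α , b ⊕ (c ℕ.∸ 3)) ∷ []

  μ-Γ-⊕ : ∀ α b c → 3 ℕ.≤ c → ∀ v → μ Γ α (b ⊕ c) v ≡ ⟦ μ-atoms α b c ⟧ v
  μ-Γ-⊕ α b c 3≤c v =
    trans (μ-Γ α (b ⊕ c) v) (cong (λ ns → ⟦ (α , b ⊕ c) ∷ map (spread α ,_) ns ⟧ v) (neighbours-⊕ b c 3≤c))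

  ∑-potential*μ : ∀ (φ : ℕ → ℕ) α b c → 3 ℕ.≤ c → c ℕ.+ 3 ℕ.< N →
    ∑ N (λ v → ℕtoℚ (φ (offset b v)) * μ Γ α (b ⊕ c) v) ≡
      α * ℕtoℚ (φ c) + (spread α * ℕtoℚ (φ (c ℕ.+ 1)) + (spread α * ℕtoℚ (φ (c ℕ.∸ 1))
        + (spread α * ℕtoℚ (φ (c ℕ.+ 3)) + (spread α * ℕtoℚ (φ (c ℕ.∸ 3)) + 0ℚ))))
  ∑-potential*μ φ α b c 3≤c c+3<N = begin
    ∑ N (λ v → h v * μ Γ α (b ⊕ c) v)
      ≡⟨ ∑-cong N (λ v → cong (h v *_) (μ-Γ-⊕ α b c 3≤c v)) ⟩
    ∑ N (λ v → h v * ⟦ μ-atoms α b c ⟧ v)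
      ≡⟨ ∑-*⟦⟧ h (μ-atoms α b c) ⟩
    α * h (b ⊕ c) + (β * h (b ⊕ (c ℕ.+ 1)) + (β * h (b ⊕ (c ℕ.∸ 1))
      + (β * h (b ⊕ (c ℕ.+ 3)) + (β * h (b ⊕ (c ℕ.∸ 3)) + 0ℚ))))
      ≡⟨ cong₂ _+_ (cong (α *_) (h-⊕ c c≤c+3))
           (cong₂ _+_ (cong (β *_) (h-⊕ (c ℕ.+ 1) (ℕ.+-monoʳ-≤ c (s≤s z≤n))))
             (cong₂ _+_ (cong (β *_) (h-⊕ (c ℕ.∸ 1) (ℕ.≤-trans (ℕ.m∸n≤m c 1) c≤c+3)))
               (cong₂ _+_ (cong (β *_) (h-⊕ (c ℕ.+ 3) ℕ.≤-refl))
                 (cong (λ t → β * t + 0ℚ) (h-⊕ (c ℕ.∸ 3) (ℕ.≤-trans (ℕ.m∸n≤m c 3) c≤c+3)))))) ⟩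
    α * ℕtoℚ (φ c) + (β * ℕtoℚ (φ (c ℕ.+ 1)) + (β * ℕtoℚ (φ (c ℕ.∸ 1))
      + (β * ℕtoℚ (φ (c ℕ.+ 3)) + (β * ℕtoℚ (φ (c ℕ.∸ 3)) + 0ℚ))))
      ∎
    where
    open ≡-Reasoning
    β = spread α
    h : Fin N → ℚ
    h v = ℕtoℚ (φ (offset b v))
    c≤c+3 : c ℕ.≤ c ℕ.+ 3
    c≤c+3 = ℕ.m≤m+n c 3
    h-⊕ : ∀ k → k ℕ.≤ c ℕ.+ 3 → h (b ⊕ k) ≡ ℕtoℚ (φ k)
    h-⊕ k k≤c+3 = cong (ℕtoℚ ∘ φ) (offset-⊕-self b k (ℕ.≤-<-trans k≤c+3 c+3<N))

  dist-⊕ : ∀ x s → T (Γ x (x ⊕ s)) → 0 ℕ.< s → s ℕ.< N → dist Γ x (x ⊕ s) ≡ 1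
  dist-⊕ x s adjacent 0<s s<N = dist-adjacent Γ x≢x⊕s adjacent
    where
    x≢x⊕s : x ≢ x ⊕ s
    x≢x⊕s x≡x⊕s = ℕ.<⇒≢ 0<s (⊕-cancelˡ x (ℕ.<-trans 0<s s<N) s<N (trans (⊕-identityʳ x) x≡x⊕s))

  dist-⊕1 : ∀ x → dist Γ x (x ⊕ 1) ≡ 1
  dist-⊕1 x = dist-⊕ x 1 adjacent (s≤s z≤n) 1<N
    where
    adjacent : T (Γ x (x ⊕ 1))
    adjacent = any⁺ {xs = neighbours x} (λ a → does (x ⊕ 1 ≟ᶠ a)) (here (T-≟-refl (x ⊕ 1)))

  dist-⊕3 : ∀ x → dist Γ x (x ⊕ 3) ≡ 1
  dist-⊕3 x = dist-⊕ x 3 adjacent (s≤s z≤n) 3<N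
    where
    adjacent : T (Γ x (x ⊕ 3))
    adjacent = any⁺ {xs = neighbours x} (λ a → does (x ⊕ 3 ≟ᶠ a)) (there (there (here (T-≟-refl (x ⊕ 3)))))

-- The two edge types

module EdgesAt (N : ℕ) .{{_ : NonZero N}} (16≤N : 16 ℕ.≤ N) (g : Fin N) where

  open Cyclic N
  open CayleyS₁₃ N 16≤N

  b : Fin N
  b = shift g -[1+ 8 ]

  p : ℕ → Fin N
  p c = b ⊕ c

  p9≡g : p 9 ≡ g
  p9≡g = ⊕-shift-negative g 8 (≤15⇒<N 9 (ℕ.m≤m+n 9 6))

  p-+ : ∀ c s → p (c ℕ.+ s) ≡ p c ⊕ s
  p-+ c s = sym (⊕-assoc b c s)

  dist-p-+1 : ∀ c → dist Γ (p c) (p (c ℕ.+ 1)) ≡ 1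
  dist-p-+1 c = subst (λ y → dist Γ (p c) y ≡ 1) (sym (p-+ c 1)) (dist-⊕1 (p c))

  dist-p-+3 : ∀ c → dist Γ (p c) (p (c ℕ.+ 3)) ≡ 1
  dist-p-+3 c = subst (λ y → dist Γ (p c) y ≡ 1) (sym (p-+ c 3)) (dist-⊕3 (p c))

  :spread : ∀ {m} → Polynomial m → Polynomial m
  :spread a = (con 1ℚ :- a) :* con (qinv (ℕtoℚ 4))

  inSupportA : ℕ → Bool
  inSupportA 6  = true
  inSupportA 8  = true
  inSupportA 9  = true
  inSupportA 12 = true
  inSupportA _  = false

  indicatorA : ℕ → ℕ
  indicatorA r = if inSupportA r then 1 else 0

  indicatorA≤1 : ∀ r → indicatorA r ℕ.≤ 1
  indicatorA≤1 r with inSupportA r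
  ... | true  = ℕ.≤-refl
  ... | false = z≤n

  transportA : ℚ → List Move
  transportA α = (α - β , p 9 , p 10 , 1) ∷ (β , p 9 , p 9 , 0) ∷ (β , p 10 , p 10 , 0)
               ∷ (β , p 8 , p 11 , 1) ∷ (β , p 12 , p 13 , 1) ∷ (β , p 6 , p 7 , 1) ∷ []
    where β = spread α

  W₁-typeA : ∀ α → ½ ≤ α → α < 1ℚ → IsW1 Γ (μ Γ α (p 9)) (μ Γ α (p 10)) (α + (1ℚ - α) * ½)
  W₁-typeA α ½≤α α<1 =
    IsW1-by-duality Γ f (≤1⇒Lipschitz Γ (indicatorA≤1 ∘ offset b))
      (λ v → ℕ.≤-trans (indicatorA≤1 (offset b v)) (ℕ.≤-trans (s≤s z≤n) 16≤N))
      gap (plan (transportA α)) coupling cost≡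
    where
    β = spread α
    f : Fin N → ℕ
    f = indicatorA ∘ offset b

    gap : ∑ N (λ x → ℕtoℚ (f x) * μ Γ α (p 9) x) - ∑ N (λ y → ℕtoℚ (f y) * μ Γ α (p 10) y)
          ≡ α + (1ℚ - α) * ½
    gap = trans
      (cong₂ _-_ (∑-potential*μ indicatorA α b 9 (ℕ.m≤m+n 3 6) (≤15⇒<N 12 (ℕ.m≤m+n 12 3)))
                 (∑-potential*μ indicatorA α b 10 (ℕ.m≤m+n 3 7) (≤15⇒<N 13 (ℕ.m≤m+n 13 2))))
      (solve 1 (λ a → let β = :spread a in
          (a :* con 1ℚ :+ (β :* con 0ℚ :+ (β :* con 1ℚ :+ (β :* con 1ℚ :+ (β :* con 1ℚ :+ con 0ℚ)))))
        :- (a :* con 0ℚ :+ (β :* con 0ℚ :+ (β :* con 1ℚ :+ (β :* con 0ℚ :+ (β :* con 0ℚ :+ con 0ℚ)))))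
        := a :+ (con 1ℚ :- a) :* con ½) refl α)

    0≤α-β : 0ℚ ≤ α - β
    0≤α-β = ℚ.≤-trans
      (ℚ.+-mono-≤ (ℚ.*-monoʳ-≤-nonNeg (ℕtoℚ 5 * qinv (ℕtoℚ 4)) (p≤q⇒0≤q-p ½≤α))
                  (ℚ.nonNegative⁻¹ (ℕtoℚ 3 * qinv (ℕtoℚ 8))))
      (ℚ.≤-reflexive (solve 1 (λ a →
         (a :- con ½) :* con (ℕtoℚ 5 * qinv (ℕtoℚ 4)) :+ con (ℕtoℚ 3 * qinv (ℕtoℚ 8)) := a :- :spread a) refl α))

    weights : NonNegWeights (transportA α)
    weights = 0≤α-β ∷ 0≤β ∷ 0≤β ∷ 0≤β ∷ 0≤β ∷ 0≤β ∷ []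
      where 0≤β = spread-nonNeg α α<1

    coupling : IsCoupling (μ Γ α (p 9)) (μ Γ α (p 10)) (plan (transportA α))
    coupling = plan-isCoupling weights
      (solve 1 (λ a → let β = :spread a in
         (a :- β) :+ (β :+ (β :+ (β :+ (β :+ (β :+ con 0ℚ))))) := con 1ℚ) refl α)
      (λ x → trans
        (solve 6 (λ a d₉ d₁₀ d₈ d₁₂ d₆ → let β = :spread a in
            (a :- β) :* d₉ :+ (β :* d₉ :+ (β :* d₁₀ :+ (β :* d₈ :+ (β :* d₁₂ :+ (β :* d₆ :+ con 0ℚ)))))
          := a :* d₉ :+ (β :* d₁₀ :+ (β :* d₈ :+ (β :* d₁₂ :+ (β :* d₆ :+ con 0ℚ)))))
          refl α (δ (p 9) x) (δ (p 10) x) (δ (p 8) x) (δ (p 12) x) (δ (p 6) x))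
        (sym (μ-Γ-⊕ α b 9 (ℕ.m≤m+n 3 6) x)))
      (λ y → trans
        (solve 6 (λ a d₁₀ d₉ d₁₁ d₁₃ d₇ → let β = :spread a in
            (a :- β) :* d₁₀ :+ (β :* d₉ :+ (β :* d₁₀ :+ (β :* d₁₁ :+ (β :* d₁₃ :+ (β :* d₇ :+ con 0ℚ)))))
          := a :* d₁₀ :+ (β :* d₁₁ :+ (β :* d₉ :+ (β :* d₁₃ :+ (β :* d₇ :+ con 0ℚ)))))
          refl α (δ (p 10) y) (δ (p 9) y) (δ (p 11) y) (δ (p 13) y) (δ (p 7) y))
        (sym (μ-Γ-⊕ α b 10 (ℕ.m≤m+n 3 7) y)))

    cost≡ : cost Γ (plan (transportA α)) ≡ α + (1ℚ - α) * ½
    cost≡ = trans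
      (cost-plan Γ (transportA α)
        (dist-p-+1 9 ∷ dist-refl Γ (p 9) ∷ dist-refl Γ (p 10) ∷ dist-p-+3 8 ∷ dist-p-+1 12 ∷ dist-p-+1 6 ∷ []))
      (solve 1 (λ a → let β = :spread a in
          (a :- β) :* con 1ℚ :+ (β :* con 0ℚ :+ (β :* con 0ℚ :+ (β :* con 1ℚ :+ (β :* con 1ℚ :+ (β :* con 1ℚ :+ con 0ℚ)))))
        := a :+ (con 1ℚ :- a) :* con ½) refl α)

  tent : ℕ → ℕ
  tent r = 3 ℕ.∸ (ℕ.∣ r - 6 ∣ ℕ.+ 2) ℕ./ 3

  tent≤3 : ∀ r → tent r ℕ.≤ 3
  tent≤3 r = ℕ.m∸n≤m 3 ((ℕ.∣ r - 6 ∣ ℕ.+ 2) ℕ./ 3)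

  tent-vanishes : ∀ r → 13 ℕ.≤ r → tent r ≡ 0
  tent-vanishes r 13≤r = ℕ.m≤n⇒m∸n≡0 (begin
    3                            ≡⟨⟩
    9 ℕ./ 3                      ≤⟨ /-monoˡ-≤ 3 (ℕ.+-monoˡ-≤ 2 7≤∣r-6∣) ⟩
    (ℕ.∣ r - 6 ∣ ℕ.+ 2) ℕ./ 3     ∎)
    where
    open ℕ.≤-Reasoning
    7≤∣r-6∣ : 7 ℕ.≤ ℕ.∣ r - 6 ∣
    7≤∣r-6∣ = subst (7 ℕ.≤_) (sym (ℕ.m≤n⇒∣n-m∣≡n∸m (ℕ.≤-trans (ℕ.m≤m+n 6 7) 13≤r))) (ℕ.∸-monoˡ-≤ 6 13≤r)

  tent-coarse : ∀ r s → s ℕ.≤ 3 → tent r ℕ.≤ suc (tent (r ℕ.+ s)) × tent (r ℕ.+ s) ℕ.≤ suc (tent r)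
  tent-coarse r s s≤3 with r ℕ.<? 13
  ... | yes r<13 = toWitness {a? = ℕ.allUpTo? (λ r → ℕ.allUpTo? (step? r) 4) 13} _ r<13 (s≤s s≤3)
    where
    step? : ∀ r s → Dec (tent r ℕ.≤ suc (tent (r ℕ.+ s)) × tent (r ℕ.+ s) ℕ.≤ suc (tent r))
    step? r s = (tent r ℕ.≤? suc (tent (r ℕ.+ s))) ×-dec (tent (r ℕ.+ s) ℕ.≤? suc (tent r))
  ... | no  r≮13
    rewrite tent-vanishes r (ℕ.≮⇒≥ r≮13)
          | tent-vanishes (r ℕ.+ s) (ℕ.≤-trans (ℕ.≮⇒≥ r≮13) (ℕ.m≤m+n r s)) = z≤n , z≤n

  tent-edge : ∀ r → r ℕ.< 3 ⊎ N ℕ.∸ 3 ℕ.≤ r → tent r ℕ.≤ 1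
  tent-edge 0 (inj₁ _) = ℕ.≤-refl
  tent-edge 1 (inj₁ _) = ℕ.≤-refl
  tent-edge 2 (inj₁ _) = ℕ.≤-refl
  tent-edge (suc (suc (suc _))) (inj₁ (s≤s (s≤s (s≤s ()))))
  tent-edge r (inj₂ N∸3≤r) =
    ℕ.≤-trans (ℕ.≤-reflexive (tent-vanishes r (ℕ.≤-trans (ℕ.∸-monoˡ-≤ 3 16≤N) N∸3≤r))) z≤n

  transportB : ℚ → List Move
  transportB α = (α , p 9 , p 12 , 1) ∷ (β , p 10 , p 13 , 1) ∷ (β , p 8 , p 11 , 1)
               ∷ (β , p 12 , p 15 , 1) ∷ (β , p 6 , p 9 , 1) ∷ []
    where β = spread α

  W₁-typeB : ∀ α → ½ ≤ α → α < 1ℚ → IsW1 Γ (μ Γ α (p 9)) (μ Γ α (p 12)) (α + (1ℚ - α) * 1ℚ)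
  W₁-typeB α ½≤α α<1 =
    IsW1-by-duality Γ (tent ∘ offset b) (windowed-Lipschitz tent tent-coarse tent-edge b)
      (λ v → ℕ.≤-trans (tent≤3 (offset b v)) (ℕ.≤-trans (ℕ.m≤m+n 3 13) 16≤N))
      gap (plan (transportB α)) coupling cost≡
    where
    gap : ∑ N (λ x → ℕtoℚ (tent (offset b x)) * μ Γ α (p 9) x)
          - ∑ N (λ y → ℕtoℚ (tent (offset b y)) * μ Γ α (p 12) y) ≡ α + (1ℚ - α) * 1ℚ
    gap = trans
      (cong₂ _-_ (∑-potential*μ tent α b 9 (ℕ.m≤m+n 3 6) (≤15⇒<N 12 (ℕ.m≤m+n 12 3)))
                 (∑-potential*μ tent α b 12 (ℕ.m≤m+n 3 9) (≤15⇒<N 15 ℕ.≤-refl)))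
      (solve 1 (λ a → let β = :spread a in
          (a :* con (ℕtoℚ 2) :+ (β :* con 1ℚ :+ (β :* con (ℕtoℚ 2) :+ (β :* con 1ℚ :+ (β :* con (ℕtoℚ 3) :+ con 0ℚ)))))
        :- (a :* con 1ℚ :+ (β :* con 0ℚ :+ (β :* con 1ℚ :+ (β :* con 0ℚ :+ (β :* con (ℕtoℚ 2) :+ con 0ℚ)))))
        := a :+ (con 1ℚ :- a) :* con 1ℚ) refl α)

    coupling : IsCoupling (μ Γ α (p 9)) (μ Γ α (p 12)) (plan (transportB α))
    coupling = plan-isCoupling {P = transportB α}
      (ℚ.≤-trans (ℚ.nonNegative⁻¹ ½) ½≤α ∷ 0≤β ∷ 0≤β ∷ 0≤β ∷ 0≤β ∷ [])
      (solve 1 (λ a → let β = :spread a in a :+ (β :+ (β :+ (β :+ (β :+ con 0ℚ)))) := con 1ℚ) refl α)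
      (λ x → sym (μ-Γ-⊕ α b 9 (ℕ.m≤m+n 3 6) x))
      (λ y → sym (μ-Γ-⊕ α b 12 (ℕ.m≤m+n 3 9) y))
      where 0≤β = spread-nonNeg α α<1

    cost≡ : cost Γ (plan (transportB α)) ≡ α + (1ℚ - α) * 1ℚ
    cost≡ = trans
      (cost-plan Γ (transportB α) (dist-p-+3 9 ∷ dist-p-+3 10 ∷ dist-p-+3 8 ∷ dist-p-+3 12 ∷ dist-p-+3 6 ∷ []))
      (solve 1 (λ a → let β = :spread a in
          a :* con 1ℚ :+ (β :* con 1ℚ :+ (β :* con 1ℚ :+ (β :* con 1ℚ :+ (β :* con 1ℚ :+ con 0ℚ))))
        := a :+ (con 1ℚ :- a) :* con 1ℚ) refl α)

  ricci-typeA : IsRicci Γ g (shift g (ℤ.+ 1)) ½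
  ricci-typeA = subst₂ (λ x y → IsRicci Γ x y ½) p9≡g (trans (p-+ 9 1) (cong (_⊕ 1) p9≡g))
    (IsRicci-by-W₁ Γ (p 9) (p 10) ½ (dist-p-+1 9) W₁-typeA)

  ricci-typeB : IsRicci Γ g (shift g (ℤ.+ 3)) 0ℚ
  ricci-typeB = subst₂ (λ x y → IsRicci Γ x y 0ℚ) p9≡g (trans (p-+ 9 3) (cong (_⊕ 3) p9≡g))
    (IsRicci-by-W₁ Γ (p 9) (p 12) 1ℚ (dist-p-+3 9) W₁-typeB)

open import Data.Integer using (+_)

proposition10 : (n : ℕ) .{{_ : NonZero n}} → n ≥ 16 → (g : Fin n) →
    IsRicci (cayley n S₁₃) g (shift g (+ 1)) ½
      × IsRicci (cayley n S₁₃) g (shift g (+ 3)) 0ℚ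
proposition10 n 16≤n g = ricci-typeA , ricci-typeB
  where open EdgesAt n 16≤n g
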